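{- Let $V_3\subset\mathbb{F}_3^4$ be a $3$-dimensional subspace such that the plane $\mathbb{P}V_3\subset\operatorname{PG}(3,3)$ contains exactly two of the four points $\langle1000\rangle,\langle0100\rangle,\langle0010\rangle,\langle0001\rangle$ (kind $\mathcal{C}_2$), let $H=\{A_\lambda:\lambda\in V_3\}$, and let $\mathcal{R}$ be any one of $\mathcal{R}_H,\mathcal{R}'_H,\mathcal{R}''_H$. Then the span $\langle\mathcal{R}\rangle$ is a $5$-dimensional projective subspace ($5$-flat) of $\operatorname{PG}(7,2)$.
   Context: Work over $\mathbb{F}_2$. $V_8=V(8,2)$ with basis $e_1,\dots,e_8$, $V_a=\langle e_1,e_8\rangle$, $V_b=\langle e_2,e_7\rangle$, $V_c=\langle e_3,e_6\rangle$, $V_d=\langle e_4,e_5\rangle$; points of $\operatorname{PG}(7,2)$ are nonzero vectors; $\omega_4$ is the set of vectors all four of whose components in $V_a,\dots,V_d$ are nonzero. Let $\zeta_a: e_1\mapsto e_8\mapsto e_1+e_8\mapsto e_1$, $\zeta_b: e_7\mapsto e_2\mapsto e_2+e_7\mapsto e_7$, $\zeta_c: e_3\mapsto e_6\mapsto e_3+e_6\mapsto e_3$, $\zeta_d: e_5\mapsto e_4\mapsto e_4+e_5\mapsto e_5$. For $\lambda=ijkl\in\mathbb{F}_3^4$ let $A_\lambda=\zeta_a^i\oplus\zeta_b^j\oplus\zeta_c^k\oplus\zeta_d^l$; these form a group $\mathcal{G}_{81}\cong(Z_3)^4$. Let $u=e_1+\dots+e_8$. For a subgroup $H\cong(Z_3)^3$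 of $\mathcal{G}_{81}$ with cosets $H,H',H''$, set $\mathcal{R}_H=\{hu:h\in H\}$, $\mathcal{R}'_H=\{hu:h\in H'\}$, $\mathcal{R}''_H=\{hu:h\in H''\}$ (27-subsets of $\omega_4$). -}

module Defs where

open import Data.Bool using (Bool; true; false; _xor_)
open import Data.Fin using (Fin; zero; suc; toℕ)
open import Data.Nat using (ℕ; zero; suc)
open import Data.Vec using (Vec; []; _∷_; zipWith; replicate; lookup; foldr)
open import Data.List using (List)
import Data.List as L
open import Data.List.Relation.Unary.All using (All)
open import Data.Product using (Σ; ∃; _×_; _,_)
open import Relation.Binary.PropositionalEquality using (_≡_)
open import Function.Bundles using (_⇔_)

F₃ : Set
F₃ = Fin 3

0₃ 1₃ 2₃ : F₃
0₃ = zero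
1₃ = suc zero
2₃ = suc (suc zero)

_+₃_ : F₃ → F₃ → F₃
zero +₃ y = y
suc zero +₃ zero = 1₃
suc zero +₃ suc zero = 2₃
suc zero +₃ suc (suc zero) = 0₃
suc (suc zero) +₃ zero = 2₃
suc (suc zero) +₃ suc zero = 0₃
suc (suc zero) +₃ suc (suc zero) = 1₃

_*₃_ : F₃ → F₃ → F₃
zero *₃ y = 0₃
suc zero *₃ y = y
suc (suc zero) *₃ zero = 0₃
suc (suc zero) *₃ suc zero = 2₃
suc (suc zero) *₃ suc (suc zero) = 1₃

F₃⁴ : Set
F₃⁴ = Vec F₃ 4

_⊞_ : F₃⁴ → F₃⁴ → F₃⁴
_⊞_ = zipWith _+₃_

_·_ : F₃ → F₃⁴ → F₃⁴
a · v = Data.Vec.map (a *₃_) v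

zero₄ : F₃⁴
zero₄ = replicate 4 0₃

unit : Fin 4 → F₃⁴
unit zero                   = 1₃ ∷ 0₃ ∷ 0₃ ∷ 0₃ ∷ []
unit (suc zero)             = 0₃ ∷ 1₃ ∷ 0₃ ∷ 0₃ ∷ []
unit (suc (suc zero))       = 0₃ ∷ 0₃ ∷ 1₃ ∷ 0₃ ∷ []
unit (suc (suc (suc zero))) = 0₃ ∷ 0₃ ∷ 0₃ ∷ 1₃ ∷ []

comb : F₃⁴ → F₃⁴ → F₃⁴ → F₃ → F₃ → F₃ → F₃⁴
comb v₁ v₂ v₃ a b c = ((a · v₁) ⊞ (b · v₂)) ⊞ (c · v₃)

LinIndep₃ : F₃⁴ → F₃⁴ → F₃⁴ → Set
LinIndep₃ v₁ v₂ v₃ =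
  ∀ a b c → comb v₁ v₂ v₃ a b c ≡ zero₄ → (a ≡ 0₃) × (b ≡ 0₃) × (c ≡ 0₃)

InSpan₃ : F₃⁴ → F₃⁴ → F₃⁴ → F₃⁴ → Set
InSpan₃ v₁ v₂ v₃ w = ∃ λ a → ∃ λ b → ∃ λ c → comb v₁ v₂ v₃ a b c ≡ w

-- V₈ = F₂⁸ with coordinates x₁ … x₈ (w.r.t. e₁ … e₈)

V₈ : Set
V₈ = Vec Bool 8

_⊕_ : V₈ → V₈ → V₈
_⊕_ = zipWith _xor_

𝟎 : V₈
𝟎 = replicate 8 false

u : V₈
u = replicate 8 true

iter : ℕ → (V₈ → V₈) → V₈ → V₈
iter zero    f x = x
iter (suc n) f x = f (iter n f x)

-- ζ_a : e₁ ↦ e₈ ↦ e₁+e₈ ↦ e₁ (acting on coordinates x₁, x₈), identity elsewhere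
ζa : V₈ → V₈
ζa (x₁ ∷ x₂ ∷ x₃ ∷ x₄ ∷ x₅ ∷ x₆ ∷ x₇ ∷ x₈ ∷ []) =
  x₈ ∷ x₂ ∷ x₃ ∷ x₄ ∷ x₅ ∷ x₆ ∷ x₇ ∷ (x₁ xor x₈) ∷ []

-- ζ_b : e₇ ↦ e₂ ↦ e₂+e₇ ↦ e₇
ζb : V₈ → V₈
ζb (x₁ ∷ x₂ ∷ x₃ ∷ x₄ ∷ x₅ ∷ x₆ ∷ x₇ ∷ x₈ ∷ []) =
  x₁ ∷ (x₂ xor x₇) ∷ x₃ ∷ x₄ ∷ x₅ ∷ x₆ ∷ x₂ ∷ x₈ ∷ []

-- ζ_c : e₃ ↦ e₆ ↦ e₃+e₆ ↦ e₃
ζc : V₈ → V₈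
ζc (x₁ ∷ x₂ ∷ x₃ ∷ x₄ ∷ x₅ ∷ x₆ ∷ x₇ ∷ x₈ ∷ []) =
  x₁ ∷ x₂ ∷ x₆ ∷ x₄ ∷ x₅ ∷ (x₃ xor x₆) ∷ x₇ ∷ x₈ ∷ []

-- ζ_d : e₅ ↦ e₄ ↦ e₄+e₅ ↦ e₅
ζd : V₈ → V₈
ζd (x₁ ∷ x₂ ∷ x₃ ∷ x₄ ∷ x₅ ∷ x₆ ∷ x₇ ∷ x₈ ∷ []) =
  x₁ ∷ x₂ ∷ x₃ ∷ (x₄ xor x₅) ∷ x₄ ∷ x₆ ∷ x₇ ∷ x₈ ∷ []

-- A_λ = ζ_a^i ⊕ ζ_b^j ⊕ ζ_c^k ⊕ ζ_d^l for λ = ijkl (the four blocks commute)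
A : F₃⁴ → V₈ → V₈
A (i ∷ j ∷ k ∷ l ∷ []) x =
  iter (toℕ i) ζa (iter (toℕ j) ζb (iter (toℕ k) ζc (iter (toℕ l) ζd x)))

Σ⊕ : List V₈ → V₈
Σ⊕ = L.foldr _⊕_ 𝟎

-- the span ⟨S⟩ of a set S ⊆ V₈ (over F₂: all finite sums of elements of S)
Span : (V₈ → Set) → V₈ → Set
Span S v = Σ (List V₈) λ xs → All S xs × (Σ⊕ xs ≡ v)

lc : ∀ {n} → Vec Bool n → Vec V₈ n → V₈
lc []            []       = 𝟎
lc (true  ∷ cs) (b ∷ bs) = b ⊕ lc cs bs
lc (false ∷ cs) (b ∷ bs) = lc cs bs

LinIndep : ∀ {n} → Vec V₈ n → Set
LinIndep {n} bs = ∀ (cs : Vec Bool n) → lc cs bs ≡ 𝟎 → cs ≡ replicate n false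

HasVecDim : (V₈ → Set) → ℕ → Set
HasVecDim W n =
  Σ (Vec V₈ n) λ bs → LinIndep bs ×
    (∀ v → W v ⇔ (∃ λ (cs : Vec Bool n) → lc cs bs ≡ v))

-- the projective subspace ℙW of PG(7,2) is a k-flat (projective dimension k)
IsFlat : (V₈ → Set) → ℕ → Set
IsFlat W k = HasVecDim W (suc k)

-- The set ℛ = {A_μ u : μ ∈ λ₀ + V₃}, a coset of H = {A_λ : λ ∈ V₃} applied to u

ℛ : F₃⁴ → F₃⁴ → F₃⁴ → F₃⁴ → V₈ → Set
ℛ λ₀ v₁ v₂ v₃ w =
  ∃ λ a → ∃ λ b → ∃ λ c → A (λ₀ ⊞ comb v₁ v₂ v₃ a b c) u ≡ w

module Submission where

-- Since e_i, e_j ∈ V₃, the subspace V₃ is determined by its projection to the two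
-- remaining coordinates k, l, which is a line of F₃². The kind-C₂ hypothesis rules out
-- the two coordinate axes (and V₃ ⊆ ⟨e_i, e_j⟩ is impossible by dimension), so the line
-- is spanned by (1, ±1) and every coset λ₀ + V₃ is {μ + s e_i + t e_j + r d} with
-- d = e_k ± e_l. Block by block, A_λ u then has an arbitrary nonzero component in V_i
-- and in V_j, and one of three components y₀, y₁, y₂ in V_k ⊕ V_l with y₀ + y₁ + y₂ = 0.
-- These 27 points span V_i ⊕ V_j ⊕ ⟨y₀, y₁⟩, a 6-dimensional space; six of them form
-- a basis, which is verified by exhaustion over the ordered pairs (i, j), the two lines
-- and the k, l-coordinates of λ₀.

open import Defs
open import Level using (0ℓ)
open import Algebra.Bundles using (CommutativeSemigroup)
import Algebra.Properties.CommutativeSemigroup as CommutativeSemigroupProperties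
open import Data.Bool using (Bool; true; false; _xor_)
import Data.Bool.Properties as Bool
open import Data.Empty using (⊥-elim)
open import Data.Fin using (Fin; zero; suc)
open import Data.Fin.Properties using (all?; any?) renaming (_≟_ to _≟ᶠ_)
open import Data.List using (List; []; _∷_)
open import Data.List.Relation.Unary.All using (All; []; _∷_)
open import Data.Nat using (zero; suc)
open import Data.Product using (Σ; ∃; _×_; _,_; proj₁; proj₂)
import Data.Product.Properties as Product
open import Data.Sum using (_⊎_; inj₁; inj₂)
open import Data.Vec using (Vec; []; _∷_; lookup; zipWith; replicate; tabulate; _[_]≔_)
import Data.Vec.Properties as Vec
open import Function.Bundles using (mk⇔)
open import Relation.Binary.PropositionalEquality
open import Relation.Binary.PropositionalEquality.Properties using (isEquivalence)
open import Relation.Nullary using (Dec; ¬_; ¬?)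
open import Relation.Nullary.Decidable using (map′; toWitness; _×-dec_; _⊎-dec_; _→-dec_)

open ≡-Reasoning

Exhaustible : Set → Set₁
Exhaustible A = {P : A → Set} → (∀ x → Dec (P x)) → Dec (∀ x → P x)

all-Bool? : Exhaustible Bool
all-Bool? P? = map′ (λ { (p , q) true → p ; (p , q) false → q }) (λ f → f true , f false)
                    (P? true ×-dec P? false)

all-×? : ∀ {A B} → Exhaustible A → Exhaustible B → Exhaustible (A × B)
all-×? allA? allB? P? = map′ (λ f x → f (proj₁ x) (proj₂ x)) (λ f a b → f (a , b))
                             (allA? λ a → allB? λ b → P? (a , b))

all-Vec? : ∀ {A n} → Exhaustible A → Exhaustible (Vec A n)
all-Vec? {n = zero}  allA? P? = map′ (λ { p [] → p }) (λ f → f []) (P? [])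
all-Vec? {n = suc n} allA? P? = map′ (λ { f (x ∷ xs) → f x xs }) (λ f x xs → f (x ∷ xs))
                                     (allA? λ x → all-Vec? allA? λ xs → P? (x ∷ xs))

_≟⁴_ : (x y : F₃⁴) → Dec (x ≡ y)
_≟⁴_ = Vec.≡-dec _≟ᶠ_

_≟⁸_ : ∀ {n} (x y : Vec Bool n) → Dec (x ≡ y)
_≟⁸_ = Vec.≡-dec Bool._≟_

abstract
  +₃-interchange : ∀ a b c d → (a +₃ b) +₃ (c +₃ d) ≡ (a +₃ c) +₃ (b +₃ d)
  +₃-interchange = toWitness {a? = all? λ a → all? λ b → all? λ c → all? λ d →
    ((a +₃ b) +₃ (c +₃ d)) ≟ᶠ ((a +₃ c) +₃ (b +₃ d))} _

  *₃-distribʳ-+₃ : ∀ x a b → (a *₃ x) +₃ (b *₃ x) ≡ (a +₃ b) *₃ x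
  *₃-distribʳ-+₃ = toWitness {a? = all? λ x → all? λ a → all? λ b →
    ((a *₃ x) +₃ (b *₃ x)) ≟ᶠ ((a +₃ b) *₃ x)} _

  *₃-distribˡ-+₃ : ∀ s a b → s *₃ (a +₃ b) ≡ (s *₃ a) +₃ (s *₃ b)
  *₃-distribˡ-+₃ = toWitness {a? = all? λ s → all? λ a → all? λ b →
    (s *₃ (a +₃ b)) ≟ᶠ ((s *₃ a) +₃ (s *₃ b))} _

  *₃-assoc : ∀ a b c → a *₃ (b *₃ c) ≡ (a *₃ b) *₃ c
  *₃-assoc = toWitness {a? = all? λ a → all? λ b → all? λ c →
    (a *₃ (b *₃ c)) ≟ᶠ ((a *₃ b) *₃ c)} _

  -- 2 = -1 in F₃
  +₃-cancel : ∀ a s → a +₃ (s +₃ (2₃ *₃ a)) ≡ s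
  +₃-cancel = toWitness {a? = all? λ a → all? λ s → (a +₃ (s +₃ (2₃ *₃ a))) ≟ᶠ s} _

lookup-extensionality : ∀ {A : Set} {n} {x y : Vec A n} → (∀ m → lookup x m ≡ lookup y m) → x ≡ y
lookup-extensionality {x = x} {y} eq = begin
  x                  ≡⟨ Vec.tabulate∘lookup x ⟨
  tabulate (lookup x) ≡⟨ Vec.tabulate-cong eq ⟩
  tabulate (lookup y) ≡⟨ Vec.tabulate∘lookup y ⟩
  y                  ∎

lookup-⊞ : ∀ x y m → lookup (x ⊞ y) m ≡ lookup x m +₃ lookup y m
lookup-⊞ x y m = Vec.lookup-zipWith _+₃_ m x y

lookup-· : ∀ s x m → lookup (s · x) m ≡ s *₃ lookup x m
lookup-· s x m = Vec.lookup-map m (s *₃_) x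

lookup-comb : ∀ v₁ v₂ v₃ a b c m → lookup (comb v₁ v₂ v₃ a b c) m
            ≡ ((a *₃ lookup v₁ m) +₃ (b *₃ lookup v₂ m)) +₃ (c *₃ lookup v₃ m)
lookup-comb v₁ v₂ v₃ a b c m = begin
  lookup (comb v₁ v₂ v₃ a b c) m
    ≡⟨ lookup-⊞ ((a · v₁) ⊞ (b · v₂)) (c · v₃) m ⟩
  lookup ((a · v₁) ⊞ (b · v₂)) m +₃ lookup (c · v₃) m
    ≡⟨ cong₂ _+₃_ (trans (lookup-⊞ (a · v₁) (b · v₂) m) (cong₂ _+₃_ (lookup-· a v₁ m) (lookup-· b v₂ m)))
                  (lookup-· c v₃ m) ⟩
  ((a *₃ lookup v₁ m) +₃ (b *₃ lookup v₂ m)) +₃ (c *₃ lookup v₃ m) ∎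

comb-⊞ : ∀ v₁ v₂ v₃ a b c a′ b′ c′ → comb v₁ v₂ v₃ a b c ⊞ comb v₁ v₂ v₃ a′ b′ c′
       ≡ comb v₁ v₂ v₃ (a +₃ a′) (b +₃ b′) (c +₃ c′)
comb-⊞ v₁ v₂ v₃ a b c a′ b′ c′ = lookup-extensionality λ m →
  let x = lookup v₁ m ; y = lookup v₂ m ; z = lookup v₃ m in begin
  lookup (comb v₁ v₂ v₃ a b c ⊞ comb v₁ v₂ v₃ a′ b′ c′) m
    ≡⟨ trans (lookup-⊞ (comb v₁ v₂ v₃ a b c) (comb v₁ v₂ v₃ a′ b′ c′) m)
             (cong₂ _+₃_ (lookup-comb v₁ v₂ v₃ a b c m) (lookup-comb v₁ v₂ v₃ a′ b′ c′ m)) ⟩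
  (((a *₃ x) +₃ (b *₃ y)) +₃ (c *₃ z)) +₃ (((a′ *₃ x) +₃ (b′ *₃ y)) +₃ (c′ *₃ z))
    ≡⟨ +₃-interchange ((a *₃ x) +₃ (b *₃ y)) (c *₃ z) ((a′ *₃ x) +₃ (b′ *₃ y)) (c′ *₃ z) ⟩
  (((a *₃ x) +₃ (b *₃ y)) +₃ ((a′ *₃ x) +₃ (b′ *₃ y))) +₃ ((c *₃ z) +₃ (c′ *₃ z))
    ≡⟨ cong (_+₃ ((c *₃ z) +₃ (c′ *₃ z))) (+₃-interchange (a *₃ x) (b *₃ y) (a′ *₃ x) (b′ *₃ y)) ⟩
  (((a *₃ x) +₃ (a′ *₃ x)) +₃ ((b *₃ y) +₃ (b′ *₃ y))) +₃ ((c *₃ z) +₃ (c′ *₃ z))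
    ≡⟨ cong₂ _+₃_ (cong₂ _+₃_ (*₃-distribʳ-+₃ x a a′) (*₃-distribʳ-+₃ y b b′)) (*₃-distribʳ-+₃ z c c′) ⟩
  (((a +₃ a′) *₃ x) +₃ ((b +₃ b′) *₃ y)) +₃ ((c +₃ c′) *₃ z)
    ≡⟨ lookup-comb v₁ v₂ v₃ (a +₃ a′) (b +₃ b′) (c +₃ c′) m ⟨
  lookup (comb v₁ v₂ v₃ (a +₃ a′) (b +₃ b′) (c +₃ c′)) m ∎

comb-· : ∀ v₁ v₂ v₃ s a b c → s · comb v₁ v₂ v₃ a b c ≡ comb v₁ v₂ v₃ (s *₃ a) (s *₃ b) (s *₃ c)
comb-· v₁ v₂ v₃ s a b c = lookup-extensionality λ m →
  let x = lookup v₁ m ; y = lookup v₂ m ; z = lookup v₃ m in begin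
  lookup (s · comb v₁ v₂ v₃ a b c) m
    ≡⟨ trans (lookup-· s (comb v₁ v₂ v₃ a b c) m) (cong (s *₃_) (lookup-comb v₁ v₂ v₃ a b c m)) ⟩
  s *₃ (((a *₃ x) +₃ (b *₃ y)) +₃ (c *₃ z))
    ≡⟨ trans (*₃-distribˡ-+₃ s ((a *₃ x) +₃ (b *₃ y)) (c *₃ z))
             (cong (_+₃ (s *₃ (c *₃ z))) (*₃-distribˡ-+₃ s (a *₃ x) (b *₃ y))) ⟩
  ((s *₃ (a *₃ x)) +₃ (s *₃ (b *₃ y))) +₃ (s *₃ (c *₃ z))
    ≡⟨ cong₂ _+₃_ (cong₂ _+₃_ (*₃-assoc s a x) (*₃-assoc s b y)) (*₃-assoc s c z) ⟩
  (((s *₃ a) *₃ x) +₃ ((s *₃ b) *₃ y)) +₃ ((s *₃ c) *₃ z)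
    ≡⟨ lookup-comb v₁ v₂ v₃ (s *₃ a) (s *₃ b) (s *₃ c) m ⟨
  lookup (comb v₁ v₂ v₃ (s *₃ a) (s *₃ b) (s *₃ c)) m ∎

module _ {v₁ v₂ v₃ : F₃⁴} where

  InSpan₃-⊞ : ∀ {x y} → InSpan₃ v₁ v₂ v₃ x → InSpan₃ v₁ v₂ v₃ y → InSpan₃ v₁ v₂ v₃ (x ⊞ y)
  InSpan₃-⊞ (a , b , c , refl) (a′ , b′ , c′ , refl) = _ , _ , _ , sym (comb-⊞ v₁ v₂ v₃ a b c a′ b′ c′)

  InSpan₃-· : ∀ s {x} → InSpan₃ v₁ v₂ v₃ x → InSpan₃ v₁ v₂ v₃ (s · x)
  InSpan₃-· s (a , b , c , refl) = _ , _ , _ , sym (comb-· v₁ v₂ v₃ s a b c)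

F₃² : Set
F₃² = F₃ × F₃

_≟²_ : (p q : F₃²) → Dec (p ≡ q)
_≟²_ = Product.≡-dec _≟ᶠ_ _≟ᶠ_

_+₂_ : F₃² → F₃² → F₃²
(a , b) +₂ (c , d) = (a +₃ c) , (b +₃ d)

_·₂_ : F₃ → F₃² → F₃²
r ·₂ (a , b) = (r *₃ a) , (r *₃ b)

0₂ : F₃²
0₂ = 0₃ , 0₃

comb₂ : F₃² → F₃² → F₃² → F₃ → F₃ → F₃ → F₃²
comb₂ p₁ p₂ p₃ a b c = ((a ·₂ p₁) +₂ (b ·₂ p₂)) +₂ (c ·₂ p₃)

InSpan₂ : F₃² → F₃² → F₃² → F₃² → Set
InSpan₂ p₁ p₂ p₃ q = ∃ λ a → ∃ λ b → ∃ λ c → comb₂ p₁ p₂ p₃ a b c ≡ q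

all-F₃²? : Exhaustible F₃²
all-F₃²? = all-×? all? all?

data Diagonal : Set where
  diag⁺ diag⁻ : Diagonal

dir : Diagonal → F₃²
dir diag⁺ = 1₃ , 1₃
dir diag⁻ = 1₃ , 2₃

all-Diagonal? : Exhaustible Diagonal
all-Diagonal? P? = map′ (λ { (p , q) diag⁺ → p ; (p , q) diag⁻ → q }) (λ f → f diag⁺ , f diag⁻)
                        (P? diag⁺ ×-dec P? diag⁻)

any-Diagonal? : {P : Diagonal → Set} → (∀ g → Dec (P g)) → Dec (Σ Diagonal P)
any-Diagonal? P? = map′ (λ { (inj₁ p) → diag⁺ , p ; (inj₂ q) → diag⁻ , q })
                        (λ { (diag⁺ , p) → inj₁ p ; (diag⁻ , q) → inj₂ q })
                        (P? diag⁺ ⊎-dec P? diag⁻)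

InSpan₂? : ∀ p₁ p₂ p₃ q → Dec (InSpan₂ p₁ p₂ p₃ q)
InSpan₂? p₁ p₂ p₃ q = any? λ a → any? λ b → any? λ c → comb₂ p₁ p₂ p₃ a b c ≟² q

abstract
  span₂-zero-axis-or-diagonal : ∀ p₁ p₂ p₃ →
      (∀ a b c → comb₂ p₁ p₂ p₃ a b c ≡ 0₂)
    ⊎ InSpan₂ p₁ p₂ p₃ (1₃ , 0₃)
    ⊎ InSpan₂ p₁ p₂ p₃ (0₃ , 1₃)
    ⊎ Σ Diagonal λ g → InSpan₂ p₁ p₂ p₃ (dir g)
                      × (∀ a b c → ∃ λ r → comb₂ p₁ p₂ p₃ a b c ≡ r ·₂ dir g)
  span₂-zero-axis-or-diagonal = toWitness {a? =
    all-F₃²? λ p₁ → all-F₃²? λ p₂ → all-F₃²? λ p₃ →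
      (all? λ a → all? λ b → all? λ c → comb₂ p₁ p₂ p₃ a b c ≟² 0₂)
    ⊎-dec InSpan₂? p₁ p₂ p₃ (1₃ , 0₃)
    ⊎-dec InSpan₂? p₁ p₂ p₃ (0₃ , 1₃)
    ⊎-dec any-Diagonal? λ g → InSpan₂? p₁ p₂ p₃ (dir g)
                        ×-dec (all? λ a → all? λ b → all? λ c → any? λ r →
                                 comb₂ p₁ p₂ p₃ a b c ≟² (r ·₂ dir g))} _

  F₃²-dependent : ∀ q₁ q₂ q₃ → ∃ λ a → ∃ λ b → ∃ λ c →
    ¬ (a ≡ 0₃ × b ≡ 0₃ × c ≡ 0₃) × comb₂ q₁ q₂ q₃ a b c ≡ 0₂
  F₃²-dependent = toWitness {a? = all-F₃²? λ q₁ → all-F₃²? λ q₂ → all-F₃²? λ q₃ →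
    any? λ a → any? λ b → any? λ c →
      ¬? ((a ≟ᶠ 0₃) ×-dec (b ≟ᶠ 0₃) ×-dec (c ≟ᶠ 0₃)) ×-dec (comb₂ q₁ q₂ q₃ a b c ≟² 0₂)} _

-- Coordinates of F₃⁴ adapted to a pair of distinct indices i, j

-- the two indices other than i and j, in increasing order (junk when i ≡ j)
others : Fin 4 → Fin 4 → Fin 4 × Fin 4
others zero             (suc zero)             = suc (suc zero) , suc (suc (suc zero))
others zero             (suc (suc zero))       = suc zero , suc (suc (suc zero))
others zero             (suc (suc (suc zero))) = suc zero , suc (suc zero)
others (suc zero)       zero                   = suc (suc zero) , suc (suc (suc zero))
others (suc zero)       (suc (suc zero))       = zero , suc (suc (suc zero))
others (suc zero)       (suc (suc (suc zero))) = zero , suc (suc zero)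
others (suc (suc zero)) zero                   = suc zero , suc (suc (suc zero))
others (suc (suc zero)) (suc zero)             = zero , suc (suc (suc zero))
others (suc (suc zero)) (suc (suc (suc zero))) = zero , suc zero
others (suc (suc (suc zero))) zero             = suc zero , suc (suc zero)
others (suc (suc (suc zero))) (suc zero)       = zero , suc (suc zero)
others (suc (suc (suc zero))) (suc (suc zero)) = zero , suc zero
others i j = i , j

at : Fin 4 → Fin 4 → F₃⁴ → F₃²
at m n x = lookup x m , lookup x n

rest : Fin 4 → Fin 4 → F₃⁴ → F₃²
rest i j = at (proj₁ (others i j)) (proj₂ (others i j))

embed : Fin 4 → Fin 4 → F₃ → F₃ → F₃² → F₃⁴
embed i j s t (p , q) =
  (((zero₄ [ i ]≔ s) [ j ]≔ t) [ proj₁ (others i j) ]≔ p) [ proj₂ (others i j) ]≔ q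

at-⊞ : ∀ m n x y → at m n (x ⊞ y) ≡ at m n x +₂ at m n y
at-⊞ m n x y = cong₂ _,_ (lookup-⊞ x y m) (lookup-⊞ x y n)

at-· : ∀ m n s x → at m n (s · x) ≡ s ·₂ at m n x
at-· m n s x = cong₂ _,_ (lookup-· s x m) (lookup-· s x n)

at-comb : ∀ m n v₁ v₂ v₃ a b c → at m n (comb v₁ v₂ v₃ a b c) ≡ comb₂ (at m n v₁) (at m n v₂) (at m n v₃) a b c
at-comb m n v₁ v₂ v₃ a b c = cong₂ _,_ (lookup-comb v₁ v₂ v₃ a b c m) (lookup-comb v₁ v₂ v₃ a b c n)

abstract
  embed-coordinates : ∀ i j → i ≢ j → ∀ s t q →
    at i j (embed i j s t q) ≡ (s , t) × rest i j (embed i j s t q) ≡ q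
  embed-coordinates = toWitness {a? = all? λ i → all? λ j → ¬? (i ≟ᶠ j) →-dec
    (all? λ s → all? λ t → all-F₃²? λ q →
      (at i j (embed i j s t q) ≟² (s , t)) ×-dec (rest i j (embed i j s t q) ≟² q))} _

  embed-decompose : ∀ i j → i ≢ j → ∀ x → x ≡ embed i j (lookup x i) (lookup x j) (rest i j x)
  embed-decompose = toWitness {a? = all? λ i → all? λ j → ¬? (i ≟ᶠ j) →-dec
    (all-Vec? all? λ x → x ≟⁴ embed i j (lookup x i) (lookup x j) (rest i j x))} _

  embed-zero : ∀ i j → i ≢ j → embed i j 0₃ 0₃ 0₂ ≡ zero₄
  embed-zero = toWitness {a? = all? λ i → all? λ j → ¬? (i ≟ᶠ j) →-dec (embed i j 0₃ 0₃ 0₂ ≟⁴ zero₄)} _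

  embed-axis : ∀ i j → i ≢ j → ∀ q → q ≡ (1₃ , 0₃) ⊎ q ≡ (0₃ , 1₃) →
    ∃ λ k → embed i j 0₃ 0₃ q ≡ unit k × k ≢ i × k ≢ j
  embed-axis = toWitness {a? = all? λ i → all? λ j → ¬? (i ≟ᶠ j) →-dec (all-F₃²? λ q →
    ((q ≟² (1₃ , 0₃)) ⊎-dec (q ≟² (0₃ , 1₃))) →-dec
      any? λ k → (embed i j 0₃ 0₃ q ≟⁴ unit k) ×-dec ¬? (k ≟ᶠ i) ×-dec ¬? (k ≟ᶠ j))} _

  embed-split : ∀ i j → i ≢ j → ∀ s t q → (s · unit i) ⊞ ((t · unit j) ⊞ embed i j 0₃ 0₃ q) ≡ embed i j s t q
  embed-split = toWitness {a? = all? λ i → all? λ j → ¬? (i ≟ᶠ j) →-dec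
    (all? λ s → all? λ t → all-F₃²? λ q →
    ((s · unit i) ⊞ ((t · unit j) ⊞ embed i j 0₃ 0₃ q)) ≟⁴ embed i j s t q)} _

  -- subtracting x_i e_i + x_j e_j, using 2 = -1 in F₃
  embed-rest : ∀ i j → i ≢ j → ∀ x →
    x ⊞ (((2₃ *₃ lookup x i) · unit i) ⊞ ((2₃ *₃ lookup x j) · unit j)) ≡ embed i j 0₃ 0₃ (rest i j x)
  embed-rest = toWitness {a? = all? λ i → all? λ j → ¬? (i ≟ᶠ j) →-dec (all-Vec? all? λ x →
    (x ⊞ (((2₃ *₃ lookup x i) · unit i) ⊞ ((2₃ *₃ lookup x j) · unit j))) ≟⁴ embed i j 0₃ 0₃ (rest i j x))} _

translate-embed : ∀ i j → i ≢ j → ∀ λ₀ s t q →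
  λ₀ ⊞ embed i j s t q ≡ embed i j (lookup λ₀ i +₃ s) (lookup λ₀ j +₃ t) (rest i j λ₀ +₂ q)
translate-embed i j i≢j λ₀ s t q = begin
  x                                                 ≡⟨ embed-decompose i j i≢j x ⟩
  embed i j (lookup x i) (lookup x j) (rest i j x)
    ≡⟨ cong₂ (λ st → embed i j (proj₁ st) (proj₂ st)) ij≡ rest≡ ⟩
  embed i j (lookup λ₀ i +₃ s) (lookup λ₀ j +₃ t) (rest i j λ₀ +₂ q) ∎
  where
  x = λ₀ ⊞ embed i j s t q
  ij≡ : at i j x ≡ (lookup λ₀ i +₃ s , lookup λ₀ j +₃ t)
  ij≡ = trans (at-⊞ i j λ₀ _) (cong (at i j λ₀ +₂_) (proj₁ (embed-coordinates i j i≢j s t q)))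
  rest≡ : rest i j x ≡ rest i j λ₀ +₂ q
  rest≡ = trans (at-⊞ _ _ λ₀ _) (cong (rest i j λ₀ +₂_) (proj₂ (embed-coordinates i j i≢j s t q)))

-- Subspaces of kind C₂

plane : Fin 4 → Fin 4 → Diagonal → F₃ → F₃ → F₃ → F₃⁴
plane i j g s t r = embed i j s t (r ·₂ dir g)

module KindC₂ {v₁ v₂ v₃ : F₃⁴} {i j : Fin 4} (i≢j : i ≢ j)
              (eᵢ∈V₃ : InSpan₃ v₁ v₂ v₃ (unit i)) (eⱼ∈V₃ : InSpan₃ v₁ v₂ v₃ (unit j)) where

  V₃ : F₃⁴ → Set
  V₃ = InSpan₃ v₁ v₂ v₃

  RestSpan : F₃² → Set
  RestSpan = InSpan₂ (rest i j v₁) (rest i j v₂) (rest i j v₃)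

  rest-comb : ∀ a b c → rest i j (comb v₁ v₂ v₃ a b c) ≡ comb₂ (rest i j v₁) (rest i j v₂) (rest i j v₃) a b c
  rest-comb = at-comb _ _ v₁ v₂ v₃

  rest-· : ∀ r x → rest i j (r · x) ≡ r ·₂ rest i j x
  rest-· = at-· _ _

  embed-rest∈V₃ : ∀ {x q} → V₃ x → rest i j x ≡ q → V₃ (embed i j 0₃ 0₃ q)
  embed-rest∈V₃ {x} x∈V₃ refl = subst V₃ (embed-rest i j i≢j x)
    (InSpan₃-⊞ x∈V₃ (InSpan₃-⊞ (InSpan₃-· _ eᵢ∈V₃) (InSpan₃-· _ eⱼ∈V₃)))

  RestSpan⇒embed∈V₃ : ∀ {q} → RestSpan q → V₃ (embed i j 0₃ 0₃ q)
  RestSpan⇒embed∈V₃ (a , b , c , eq) = embed-rest∈V₃ (a , b , c , refl) (trans (rest-comb a b c) eq)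

  embed∈V₃ : ∀ {q} → V₃ (embed i j 0₃ 0₃ q) → ∀ s t → V₃ (embed i j s t q)
  embed∈V₃ {q} e∈V₃ s t = subst V₃ (embed-split i j i≢j s t q)
    (InSpan₃-⊞ (InSpan₃-· s eᵢ∈V₃) (InSpan₃-⊞ (InSpan₃-· t eⱼ∈V₃) e∈V₃))

  V₃⊈⟨eᵢ,eⱼ⟩ : LinIndep₃ v₁ v₂ v₃ →
    ¬ (∀ a b c → comb₂ (rest i j v₁) (rest i j v₂) (rest i j v₃) a b c ≡ 0₂)
  V₃⊈⟨eᵢ,eⱼ⟩ indep rest≡0 with F₃²-dependent (at i j v₁) (at i j v₂) (at i j v₃)
  ... | a , b , c , nontrivial , ij≡0 = nontrivial (indep a b c x≡0)
    where
    x = comb v₁ v₂ v₃ a b c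
    x≡0 : x ≡ zero₄
    x≡0 = begin
      x                                                 ≡⟨ embed-decompose i j i≢j x ⟩
      embed i j (lookup x i) (lookup x j) (rest i j x)  ≡⟨ cong₂ (λ st → embed i j (proj₁ st) (proj₂ st))
                                                                 (trans (at-comb i j v₁ v₂ v₃ a b c) ij≡0)
                                                                 (trans (rest-comb a b c) (rest≡0 a b c)) ⟩
      embed i j 0₃ 0₃ 0₂                                ≡⟨ embed-zero i j i≢j ⟩
      zero₄                                             ∎

  axis∉RestSpan : (∀ k → V₃ (unit k) → k ≡ i ⊎ k ≡ j) →
    ∀ q → q ≡ (1₃ , 0₃) ⊎ q ≡ (0₃ , 1₃) → ¬ RestSpan q
  axis∉RestSpan only q axis q∈ with embed-axis i j i≢j q axis
  ... | k , embed≡eₖ , k≢i , k≢j with only k (subst V₃ embed≡eₖ (RestSpan⇒embed∈V₃ q∈))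
  ...   | inj₁ k≡i = k≢i k≡i
  ...   | inj₂ k≡j = k≢j k≡j

  V₃-is-plane : LinIndep₃ v₁ v₂ v₃ → (∀ k → V₃ (unit k) → k ≡ i ⊎ k ≡ j) →
    Σ Diagonal λ g → (∀ s t r → V₃ (plane i j g s t r))
                   × (∀ {x} → V₃ x → ∃ λ s → ∃ λ t → ∃ λ r → x ≡ plane i j g s t r)
  V₃-is-plane indep only with span₂-zero-axis-or-diagonal (rest i j v₁) (rest i j v₂) (rest i j v₃)
  ... | inj₁ rest≡0                = ⊥-elim (V₃⊈⟨eᵢ,eⱼ⟩ indep rest≡0)
  ... | inj₂ (inj₁ e₁∈)            = ⊥-elim (axis∉RestSpan only _ (inj₁ refl) e₁∈)
  ... | inj₂ (inj₂ (inj₁ e₂∈))     = ⊥-elim (axis∉RestSpan only _ (inj₂ refl) e₂∈)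
  ... | inj₂ (inj₂ (inj₂ (g , (a , b , c , eq) , on-line))) = g , plane⊆V₃ , V₃⊆plane
    where
    plane⊆V₃ : ∀ s t r → V₃ (plane i j g s t r)
    plane⊆V₃ s t r = embed∈V₃ (embed-rest∈V₃ (InSpan₃-· r (a , b , c , refl))
      (trans (rest-· r (comb v₁ v₂ v₃ a b c)) (cong (r ·₂_) (trans (rest-comb a b c) eq)))) s t
    V₃⊆plane : ∀ {x} → V₃ x → ∃ λ s → ∃ λ t → ∃ λ r → x ≡ plane i j g s t r
    V₃⊆plane (a′ , b′ , c′ , refl) with on-line a′ b′ c′
    ... | r , rest≡ = _ , _ , r , trans (embed-decompose i j i≢j _)
                                         (cong (embed i j _ _) (trans (rest-comb a′ b′ c′) rest≡))

⊕-commutativeSemigroup : CommutativeSemigroup 0ℓ 0ℓ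
⊕-commutativeSemigroup = record
  { Carrier = V₈
  ; _≈_ = _≡_
  ; _∙_ = _⊕_
  ; isCommutativeSemigroup = record
    { isSemigroup = record
      { isMagma = record { isEquivalence = isEquivalence ; ∙-cong = cong₂ _⊕_ }
      ; assoc = Vec.zipWith-assoc Bool.xor-assoc
      }
    ; comm = Vec.zipWith-comm Bool.xor-comm
    }
  }

open CommutativeSemigroupProperties ⊕-commutativeSemigroup using (interchange; x∙yz≈y∙xz)
open CommutativeSemigroup ⊕-commutativeSemigroup using (assoc)

xor-self : ∀ {n} (x : Vec Bool n) → zipWith _xor_ x x ≡ replicate n false
xor-self []      = refl
xor-self (b ∷ x) = cong₂ _∷_ (Bool.xor-same b) (xor-self x)

⊕-identityˡ : ∀ x → 𝟎 ⊕ x ≡ x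
⊕-identityˡ = Vec.zipWith-identityˡ Bool.xor-identityˡ

lc-zero : ∀ {n} (bs : Vec V₈ n) → lc (replicate n false) bs ≡ 𝟎
lc-zero []       = refl
lc-zero (b ∷ bs) = lc-zero bs

lc-xor : ∀ {n} (cs cs′ : Vec Bool n) (bs : Vec V₈ n) → lc (zipWith _xor_ cs cs′) bs ≡ lc cs bs ⊕ lc cs′ bs
lc-xor []           []            []       = refl
lc-xor (true ∷ cs)  (true ∷ cs′)  (b ∷ bs) = begin
  lc (zipWith _xor_ cs cs′) bs        ≡⟨ lc-xor cs cs′ bs ⟩
  lc cs bs ⊕ lc cs′ bs                ≡⟨ ⊕-identityˡ _ ⟨
  𝟎 ⊕ (lc cs bs ⊕ lc cs′ bs)          ≡⟨ cong (_⊕ (lc cs bs ⊕ lc cs′ bs)) (xor-self b) ⟨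
  (b ⊕ b) ⊕ (lc cs bs ⊕ lc cs′ bs)    ≡⟨ interchange b b (lc cs bs) (lc cs′ bs) ⟩
  (b ⊕ lc cs bs) ⊕ (b ⊕ lc cs′ bs)    ∎
lc-xor (true ∷ cs)  (false ∷ cs′) (b ∷ bs) =
  trans (cong (b ⊕_) (lc-xor cs cs′ bs)) (sym (assoc b (lc cs bs) (lc cs′ bs)))
lc-xor (false ∷ cs) (true ∷ cs′)  (b ∷ bs) =
  trans (cong (b ⊕_) (lc-xor cs cs′ bs)) (x∙yz≈y∙xz b (lc cs bs) (lc cs′ bs))
lc-xor (false ∷ cs) (false ∷ cs′) (b ∷ bs) = lc-xor cs cs′ bs

selected : ∀ {n} → Vec Bool n → Vec V₈ n → List V₈
selected []           []       = []
selected (true ∷ cs)  (b ∷ bs) = b ∷ selected cs bs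
selected (false ∷ cs) (b ∷ bs) = selected cs bs

Σ⊕-selected : ∀ {n} (cs : Vec Bool n) bs → Σ⊕ (selected cs bs) ≡ lc cs bs
Σ⊕-selected []           []       = refl
Σ⊕-selected (true ∷ cs)  (b ∷ bs) = cong (b ⊕_) (Σ⊕-selected cs bs)
Σ⊕-selected (false ∷ cs) (b ∷ bs) = Σ⊕-selected cs bs

All-selected : ∀ {P : V₈ → Set} {n} (bs : Vec V₈ n) → (∀ m → P (lookup bs m)) → ∀ cs → All P (selected cs bs)
All-selected []       bs⊆P []           = []
All-selected (b ∷ bs) bs⊆P (true ∷ cs)  = bs⊆P zero ∷ All-selected bs (λ m → bs⊆P (suc m)) cs
All-selected (b ∷ bs) bs⊆P (false ∷ cs) = All-selected bs (λ m → bs⊆P (suc m)) cs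

Combination : ∀ {n} → Vec V₈ n → V₈ → Set
Combination {n} bs v = ∃ λ (cs : Vec Bool n) → lc cs bs ≡ v

module _ (S : V₈ → Set) {n} (bs : Vec V₈ n) where

  Span⊆Combination : (∀ {w} → S w → Combination bs w) → ∀ {v} → Span S v → Combination bs v
  Span⊆Combination S⊆ ([] , [] , refl) = replicate n false , lc-zero bs
  Span⊆Combination S⊆ (w ∷ ws , w∈S ∷ ws⊆S , refl)
    with S⊆ w∈S | Span⊆Combination S⊆ (ws , ws⊆S , refl)
  ... | cs , refl | cs′ , eq = zipWith _xor_ cs cs′ , trans (lc-xor cs cs′ bs) (cong (lc cs bs ⊕_) eq)

  hasVecDim-Span : LinIndep bs → (∀ m → S (lookup bs m)) → (∀ {w} → S w → Combination bs w) →
                   HasVecDim (Span S) n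
  hasVecDim-Span indep bs⊆S S⊆ = bs , indep , λ v → mk⇔ (Span⊆Combination S⊆)
    λ { (cs , refl) → selected cs bs , All-selected bs bs⊆S cs , Σ⊕-selected cs bs }

-- The 27 points of ℛ

point : Fin 4 → Fin 4 → Diagonal → F₃² → F₃ → F₃ → F₃ → V₈
point i j g y s t r = A (embed i j s t (y +₂ (r ·₂ dir g))) u

basis : Fin 4 → Fin 4 → Diagonal → F₃² → Vec V₈ 6
basis i j g y = point i j g y 0₃ 0₃ 0₃ ∷ point i j g y 1₃ 0₃ 0₃ ∷ point i j g y 2₃ 0₃ 0₃
              ∷ point i j g y 0₃ 1₃ 0₃ ∷ point i j g y 0₃ 2₃ 0₃ ∷ point i j g y 0₃ 0₃ 1₃ ∷ []

-- Write point s t r = X_s + Y_t + Z_r blockwise (in V_i, V_j, V_k ⊕ V_l). Since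
-- X₀ + X₁ + X₂ = Y₀ + Y₁ + Y₂ = Z₀ + Z₁ + Z₂ = 0, in terms of the basis b₀ … b₅ the
-- difference X_s - X₀ is 0, b₀ + b₁ or b₀ + b₂, similarly for Y, and Z_r - Z₀ is 0,
-- b₀ + b₅ or Z₁ = b₁ + b₂ + b₃ + b₄ + b₅.
coordinates : F₃ → F₃ → F₃ → Vec Bool 6
coordinates s t r = (((true ∷ false ∷ false ∷ false ∷ false ∷ false ∷ []) ⊻ δX s) ⊻ δY t) ⊻ δZ r
  where
  _⊻_ : Vec Bool 6 → Vec Bool 6 → Vec Bool 6
  _⊻_ = zipWith _xor_
  δX δY δZ : F₃ → Vec Bool 6
  δX zero             = replicate 6 false
  δX (suc zero)       = true ∷ true ∷ false ∷ false ∷ false ∷ false ∷ []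
  δX (suc (suc zero)) = true ∷ false ∷ true ∷ false ∷ false ∷ false ∷ []
  δY zero             = replicate 6 false
  δY (suc zero)       = true ∷ false ∷ false ∷ true ∷ false ∷ false ∷ []
  δY (suc (suc zero)) = true ∷ false ∷ false ∷ false ∷ true ∷ false ∷ []
  δZ zero             = replicate 6 false
  δZ (suc zero)       = true ∷ false ∷ false ∷ false ∷ false ∷ true ∷ []
  δZ (suc (suc zero)) = false ∷ true ∷ true ∷ true ∷ true ∷ true ∷ []

abstract
  basis-independent : ∀ i j → i ≢ j → ∀ g y → LinIndep (basis i j g y)
  basis-independent = toWitness {a? = all? λ i → all? λ j → ¬? (i ≟ᶠ j) →-dec
    (all-Diagonal? λ g → all-F₃²? λ y → all-Vec? all-Bool? λ cs →
      (lc cs (basis i j g y) ≟⁸ 𝟎) →-dec (cs ≟⁸ replicate 6 false))} _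

  lc-coordinates : ∀ i j → i ≢ j → ∀ g y s t r → lc (coordinates s t r) (basis i j g y) ≡ point i j g y s t r
  lc-coordinates = toWitness {a? = all? λ i → all? λ j → ¬? (i ≟ᶠ j) →-dec
    (all-Diagonal? λ g → all-F₃²? λ y → all? λ s → all? λ t → all? λ r →
      lc (coordinates s t r) (basis i j g y) ≟⁸ point i j g y s t r)} _

module _ {v₁ v₂ v₃ : F₃⁴} {i j : Fin 4} (i≢j : i ≢ j) (g : Diagonal) (λ₀ : F₃⁴)
         (plane⊆V₃ : ∀ s t r → InSpan₃ v₁ v₂ v₃ (plane i j g s t r))
         (V₃⊆plane : ∀ {x} → InSpan₃ v₁ v₂ v₃ x → ∃ λ s → ∃ λ t → ∃ λ r → x ≡ plane i j g s t r) where

  point∈ℛ : ∀ s t r → ℛ λ₀ v₁ v₂ v₃ (point i j g (rest i j λ₀) s t r)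
  point∈ℛ s t r with plane⊆V₃ (s +₃ (2₃ *₃ lookup λ₀ i)) (t +₃ (2₃ *₃ lookup λ₀ j)) r
  ... | a , b , c , eq = a , b , c , cong (λ μ → A μ u) (begin
    λ₀ ⊞ comb v₁ v₂ v₃ a b c
      ≡⟨ cong (λ₀ ⊞_) eq ⟩
    λ₀ ⊞ plane i j g (s +₃ (2₃ *₃ lookup λ₀ i)) (t +₃ (2₃ *₃ lookup λ₀ j)) r
      ≡⟨ translate-embed i j i≢j λ₀ _ _ _ ⟩
    embed i j (lookup λ₀ i +₃ (s +₃ (2₃ *₃ lookup λ₀ i))) (lookup λ₀ j +₃ (t +₃ (2₃ *₃ lookup λ₀ j))) _
      ≡⟨ cong₂ (λ s′ t′ → embed i j s′ t′ _) (+₃-cancel (lookup λ₀ i) s) (+₃-cancel (lookup λ₀ j) t) ⟩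
    embed i j s t (rest i j λ₀ +₂ (r ·₂ dir g)) ∎)

  ℛ⊆points : ∀ {w} → ℛ λ₀ v₁ v₂ v₃ w → ∃ λ s → ∃ λ t → ∃ λ r → point i j g (rest i j λ₀) s t r ≡ w
  ℛ⊆points (a , b , c , refl) with V₃⊆plane (a , b , c , refl)
  ... | s , t , r , eq = _ , _ , r ,
    cong (λ μ → A μ u) (sym (trans (cong (λ₀ ⊞_) eq) (translate-embed i j i≢j λ₀ s t _)))

  Span-ℛ-is-5-flat : IsFlat (Span (ℛ λ₀ v₁ v₂ v₃)) 5
  Span-ℛ-is-5-flat =
    hasVecDim-Span (ℛ λ₀ v₁ v₂ v₃) (basis i j g y) (basis-independent i j i≢j g y) basis⊆ℛ ℛ⊆basis
    where
    y = rest i j λ₀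
    basis⊆ℛ : ∀ m → ℛ λ₀ v₁ v₂ v₃ (lookup (basis i j g y) m)
    basis⊆ℛ zero                                = point∈ℛ 0₃ 0₃ 0₃
    basis⊆ℛ (suc zero)                          = point∈ℛ 1₃ 0₃ 0₃
    basis⊆ℛ (suc (suc zero))                    = point∈ℛ 2₃ 0₃ 0₃
    basis⊆ℛ (suc (suc (suc zero)))              = point∈ℛ 0₃ 1₃ 0₃
    basis⊆ℛ (suc (suc (suc (suc zero))))        = point∈ℛ 0₃ 2₃ 0₃
    basis⊆ℛ (suc (suc (suc (suc (suc zero))))) = point∈ℛ 0₃ 0₃ 1₃
    ℛ⊆basis : ∀ {w} → ℛ λ₀ v₁ v₂ v₃ w → Combination (basis i j g y) w
    ℛ⊆basis w∈ℛ with ℛ⊆points w∈ℛ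
    ... | s , t , r , eq = coordinates s t r , trans (lc-coordinates i j i≢j g y s t r) eq

theorem7 : (v₁ v₂ v₃ : F₃⁴) → LinIndep₃ v₁ v₂ v₃
         → (i j : Fin 4) → i ≢ j
         → InSpan₃ v₁ v₂ v₃ (unit i) → InSpan₃ v₁ v₂ v₃ (unit j)
         → ((k : Fin 4) → InSpan₃ v₁ v₂ v₃ (unit k) → (k ≡ i) ⊎ (k ≡ j))
         → (λ₀ : F₃⁴) → IsFlat (Span (ℛ λ₀ v₁ v₂ v₃)) 5
theorem7 v₁ v₂ v₃ indep i j i≢j eᵢ∈V₃ eⱼ∈V₃ only λ₀
  with KindC₂.V₃-is-plane i≢j eᵢ∈V₃ eⱼ∈V₃ indep only
... | g , plane⊆V₃ , V₃⊆plane = Span-ℛ-is-5-flat i≢j g λ₀ plane⊆V₃ V₃⊆plane
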